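{- Suppose $\mathcal{M}$ is a nonstandard model of $\mathrm{ZF}$ and $S\subseteq M$ is separative over $\mathcal{M}$. Suppose further that there is a first-order formula $\theta(x,\bar y)$ in the language $\{\in,\mathrm{S}\}$ and a tuple of parameters $\bar m$ from $M$ such that $(\mathcal{M},S)\models\theta(\alpha,\bar m)$ for every $\alpha\in\mathrm{o}(\mathcal{M})$. Then there is a nonstandard $\gamma\in\mathrm{Ord}^{\mathcal{M}}$ such that $(\mathcal{M},S)\models\theta(\gamma,\bar m)$.
   Context: $\mathcal{M}=(M,\in^{\mathcal{M}})$ is nonstandard if $\in^{\mathcal{M}}$ is ill-founded. $\mathrm{WF}(\mathcal{M})$ is the well-founded part of $\mathcal{M}$ (elements with no infinite $\in^{\mathcal{M}}$-descending sequence), identified with its transitive collapse; an ordinal of $\mathcal{M}$ is nonstandard if it is not in $\mathrm{WF}(\mathcal{M})$; $\mathrm{o}(\mathcal{M})$ is the supremum of the ordinals in $\mathrm{WF}(\mathcal{M})$ (so elements of $\mathrm{o}(\mathcal{M})$ are identified with the corresponding standard ordinals of $\mathcal{M}$). $S\subseteq M$ is separative over $\mathcal{M}$ if $(\mathcal{M},S)$ satisfies the Separation scheme for all formulae of the language $\{\in,\mathrm{S}\}$, with $\mathrm{S}$ interpreted as $S$. -}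

module Defs where

open import Data.Nat using (ℕ; zero; suc; _≟_)
open import Data.Product using (Σ; _×_; _,_)
open import Data.Sum using (_⊎_)
open import Data.Empty using (⊥)
open import Data.Unit using (⊤)
open import Relation.Nullary using (¬_; yes; no)
open import Relation.Binary.PropositionalEquality using (_≡_)

_↔_ : Set → Set → Set
A ↔ B = (A → B) × (B → A)
infix 3 _↔_

data Formula : Set where
  _∈'_  : ℕ → ℕ → Formula
  _≐_   : ℕ → ℕ → Formula
  S'    : ℕ → Formula
  ⊥'    : Formula
  ¬'_   : Formula → Formula
  _∧'_  : Formula → Formula → Formula
  _∨'_  : Formula → Formula → Formula
  _⇒'_  : Formula → Formula → Formula
  ∀'    : ℕ → Formula → Formula
  ∃'    : ℕ → Formula → Formula

NoS : Formula → Set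
NoS (x ∈' y) = ⊤
NoS (x ≐ y) = ⊤
NoS (S' x) = ⊥
NoS ⊥' = ⊤
NoS (¬' φ) = NoS φ
NoS (φ ∧' ψ) = NoS φ × NoS ψ
NoS (φ ∨' ψ) = NoS φ × NoS ψ
NoS (φ ⇒' ψ) = NoS φ × NoS ψ
NoS (∀' x φ) = NoS φ
NoS (∃' x φ) = NoS φ

_[_↦_] : {M : Set} → (ℕ → M) → ℕ → M → (ℕ → M)
(ρ [ x ↦ a ]) y with y ≟ x
... | yes _ = a
... | no  _ = ρ y

Sat : {M : Set} → (M → M → Set) → (M → Set) → (ℕ → M) → Formula → Set
Sat E S ρ (x ∈' y) = E (ρ x) (ρ y)
Sat E S ρ (x ≐ y) = ρ x ≡ ρ y
Sat E S ρ (S' x) = S (ρ x)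
Sat E S ρ ⊥' = ⊥
Sat E S ρ (¬' φ) = ¬ Sat E S ρ φ
Sat E S ρ (φ ∧' ψ) = Sat E S ρ φ × Sat E S ρ ψ
Sat E S ρ (φ ∨' ψ) = Sat E S ρ φ ⊎ Sat E S ρ ψ
Sat E S ρ (φ ⇒' ψ) = Sat E S ρ φ → Sat E S ρ ψ
Sat {M} E S ρ (∀' x φ) = (a : M) → Sat E S (ρ [ x ↦ a ]) φ
Sat {M} E S ρ (∃' x φ) = Σ M λ a → Sat E S (ρ [ x ↦ a ]) φ

-- satisfaction of a pure ∈-formula in (M, E) (S is irrelevant for such φ)
Sat∈ : {M : Set} → (M → M → Set) → (ℕ → M) → Formula → Set
Sat∈ E = Sat E (λ _ → ⊥)

-- In the schemas, variable 0 is the "x" variable (and 1 the "y" variable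
-- in Replacement); all other variables are parameters given by ρ.

record ZF (M : Set) (E : M → M → Set) : Set₁ where
  field
    extensionality : ∀ a b → (∀ x → E x a ↔ E x b) → a ≡ b
    foundation     : ∀ a → Σ M (λ x → E x a) →
                     Σ M λ x → E x a × (∀ y → E y x → ¬ E y a)
    pairing        : ∀ a b → Σ M λ c → ∀ x → E x c ↔ (x ≡ a ⊎ x ≡ b)
    union          : ∀ a → Σ M λ u → ∀ x → E x u ↔ Σ M (λ y → E y a × E x y)
    powerset       : ∀ a → Σ M λ p → ∀ x → E x p ↔ (∀ z → E z x → E z a)
    infinity       : Σ M λ w →
                       (Σ M λ e → E e w × (∀ z → ¬ E z e)) ×
                       (∀ x → E x w → Σ M λ s → E s w × (∀ z → E z s ↔ (E z x ⊎ z ≡ x)))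
    separation     : ∀ (φ : Formula) → NoS φ → ∀ (ρ : ℕ → M) (a : M) →
                     Σ M λ b → ∀ x → E x b ↔ (E x a × Sat∈ E (ρ [ 0 ↦ x ]) φ)
    replacement    : ∀ (φ : Formula) → NoS φ → ∀ (ρ : ℕ → M) (a : M) →
                     (∀ x → E x a → Σ M λ y → Sat∈ E ((ρ [ 0 ↦ x ]) [ 1 ↦ y ]) φ ×
                        (∀ y' → Sat∈ E ((ρ [ 0 ↦ x ]) [ 1 ↦ y' ]) φ → y' ≡ y)) →
                     Σ M λ b → ∀ y → E y b ↔
                        Σ M (λ x → E x a × Sat∈ E ((ρ [ 0 ↦ x ]) [ 1 ↦ y ]) φ)

Separative : (M : Set) (E : M → M → Set) (S : M → Set) → Set
Separative M E S = ∀ (φ : Formula) (ρ : ℕ → M) (a : M) →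
  Σ M λ b → ∀ x → E x b ↔ (E x a × Sat E S (ρ [ 0 ↦ x ]) φ)

Descending : {M : Set} → (M → M → Set) → (ℕ → M) → Set
Descending E f = ∀ n → E (f (suc n)) (f n)

NonStandard : (M : Set) → (M → M → Set) → Set
NonStandard M E = Σ (ℕ → M) (Descending E)

InWF : {M : Set} → (M → M → Set) → M → Set
InWF {M} E a = ¬ Σ (ℕ → M) (λ f → f 0 ≡ a × Descending E f)

IsOrd : {M : Set} → (M → M → Set) → M → Set
IsOrd E a = (∀ x y → E x a → E y x → E y a) ×
            (∀ x y → E x a → E y a → (E x y ⊎ x ≡ y ⊎ E y x))

-- An ill-founded model of ZF has a nonstandard ordinal: put an infinite descending sequence
-- inside a transitive set T (by recursion along ω) and take ranks on T, which are ordinals of the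
-- model and descend along the sequence. Given such a δ, suppose θ held of no nonstandard ordinal.
-- The set X = { α ∈ δ : θ(α) }, which exists since S is separative, is then the set of well-founded
-- ordinals below δ: a transitive set of ordinals, hence an ordinal, and itself well-founded. So
-- X ∈ δ (as X ≠ δ) and θ(X), i.e. X ∈ X. Both recursions are carried out inside the model by
-- gluing all set-sized partial solutions with Replacement, and use excluded middle only to pick
-- ∈-minimal counterexamples.

module Submission where

open import Defs
open import Level using (0ℓ)
open import Data.Nat using (ℕ; zero; suc)
open import Data.Product using (Σ; _×_; _,_; proj₁; proj₂; map₂)
open import Data.Sum using (_⊎_; inj₁; inj₂)
open import Data.Empty using (⊥; ⊥-elim)
open import Relation.Nullary using (¬_; yes; no)
open import Relation.Binary.PropositionalEquality using (_≡_; refl; sym; trans; subst)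
open import Axiom.ExcludedMiddle using (ExcludedMiddle)
open import Axiom.DoubleNegationElimination using (em⇒dne)

module _ {M : Set} {E : M → M → Set} where

  InWF-∈-closed : ∀ {y z} → E z y → InWF E y → InWF E z
  InWF-∈-closed {y} zy wf-y (s , refl , ds) = wf-y (s′ , refl , ds′)
    where
    s′ : ℕ → M
    s′ zero = y
    s′ (suc n) = s n
    ds′ : Descending E s′
    ds′ zero = zy
    ds′ (suc n) = ds n

  members-InWF⇒InWF : ∀ {a} → (∀ x → E x a → InWF E x) → InWF E a
  members-InWF⇒InWF wf (s , refl , ds) = wf (s 1) (ds 0) ((λ n → s (suc n)) , refl , λ n → ds (suc n))

  ∈-refl⇒¬InWF : ∀ {a} → E a a → ¬ InWF E a
  ∈-refl⇒¬InWF aa wf = wf ((λ _ → _) , refl , λ _ → aa)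

_⇔'_ : Formula → Formula → Formula
φ ⇔' ψ = (φ ⇒' ψ) ∧' (ψ ⇒' φ)

infixr 4 _⇔'_

kpairFormula : ℕ → ℕ → ℕ → Formula
kpairFormula p x v =
  ∀' 90 ((90 ∈' p) ⇔' (∀' 91 ((91 ∈' 90) ⇔' (91 ≐ x)) ∨' ∀' 91 ((91 ∈' 90) ⇔' ((91 ≐ x) ∨' (91 ≐ v)))))

isOrdFormula : ℕ → Formula
isOrdFormula a =
  ∀' 70 (∀' 71 ((70 ∈' a) ⇒' ((71 ∈' 70) ⇒' (71 ∈' a)))) ∧'
  ∀' 70 (∀' 71 ((70 ∈' a) ⇒' ((71 ∈' a) ⇒' ((70 ∈' 71) ∨' ((70 ≐ 71) ∨' (71 ∈' 70))))))

module ZFBasics {M : Set} {E : M → M → Set} (zf : ZF M E) where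
  open ZF zf

  _⊆_ : M → M → Set
  a ⊆ b = ∀ x → E x a → E x b

  IsTransitiveSet : M → Set
  IsTransitiveSet a = ∀ y z → E y a → E z y → E z a

  ⊆-antisym : ∀ {a b} → a ⊆ b → b ⊆ a → a ≡ b
  ⊆-antisym {a} {b} a⊆b b⊆a = extensionality a b λ x → a⊆b x , b⊆a x

  same-members : ∀ {a b} {P : M → Set} → (∀ x → E x a ↔ P x) → (∀ x → E x b ↔ P x) → a ≡ b
  same-members ha hb = ⊆-antisym (λ x xa → proj₂ (hb x) (proj₁ (ha x) xa)) (λ x xb → proj₂ (ha x) (proj₁ (hb x) xb))

  ∈-minimal : ∀ b (P : M → Set) → (∀ x → E x b ↔ P x) → ∀ x → P x →
              Σ M λ m → P m × (∀ y → E y m → ¬ P y)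
  ∈-minimal b P hb x px with foundation b (x , proj₂ (hb x) px)
  ... | m , mb , min = m , proj₁ (hb m) mb , λ y ym py → min y ym (proj₂ (hb y) py)

  ∈-induction : ∀ b (Bad : M → Set) → (∀ x → E x b ↔ Bad x) →
                (∀ x → (∀ y → E y x → ¬ Bad y) → ¬ Bad x) → ∀ x → ¬ Bad x
  ∈-induction b Bad hb step x bad with ∈-minimal b Bad hb x bad
  ... | m , bad-m , below = step m below bad-m

  IsSingleton : M → M → Set
  IsSingleton s a = ∀ w → E w s ↔ w ≡ a

  IsUPair : M → M → M → Set
  IsUPair s a b = ∀ w → E w s ↔ (w ≡ a ⊎ w ≡ b)

  singleton : ∀ a → Σ M λ s → IsSingleton s a
  singleton a with pairing a a
  ... | s , hs = s , λ w → (λ ws → same (proj₁ (hs w) ws)) , λ w≡a → proj₂ (hs w) (inj₁ w≡a)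
    where
    same : ∀ {w} → w ≡ a ⊎ w ≡ a → w ≡ a
    same (inj₁ e) = e
    same (inj₂ e) = e

  union₂ : ∀ a b → Σ M λ s → ∀ z → E z s ↔ (E z a ⊎ E z b)
  union₂ a b with pairing a b
  ... | p , hp with union p
  ... | s , hs = s , λ z → to z , from z
    where
    to : ∀ z → E z s → E z a ⊎ E z b
    to z zs with proj₁ (hs z) zs
    ... | y , yp , zy with proj₁ (hp y) yp
    ... | inj₁ refl = inj₁ zy
    ... | inj₂ refl = inj₂ zy
    from : ∀ z → E z a ⊎ E z b → E z s
    from z (inj₁ za) = proj₂ (hs z) (a , proj₂ (hp a) (inj₁ refl) , za)
    from z (inj₂ zb) = proj₂ (hs z) (b , proj₂ (hp b) (inj₂ refl) , zb)

  adjoin : ∀ a b → Σ M λ s → ∀ z → E z s ↔ (E z a ⊎ z ≡ b)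
  adjoin a b with singleton b
  ... | t , ht with union₂ a t
  ... | s , hs = s , λ z → to z , from z
    where
    to : ∀ z → E z s → E z a ⊎ z ≡ b
    to z zs with proj₁ (hs z) zs
    ... | inj₁ za = inj₁ za
    ... | inj₂ zt = inj₂ (proj₁ (ht z) zt)
    from : ∀ z → E z a ⊎ z ≡ b → E z s
    from z (inj₁ za) = proj₂ (hs z) (inj₁ za)
    from z (inj₂ z≡b) = proj₂ (hs z) (inj₂ (proj₂ (ht z) z≡b))

  no-∈-minimal-member : ∀ {t x} → E x t → (∀ m → E m t → Σ M λ y → E y m × E y t) → ⊥
  no-∈-minimal-member {t} {x} xt pred with foundation t (x , xt)
  ... | m , mt , min with pred m mt
  ... | y , ym , yt = min y ym yt

  ∈-asym : ∀ {a b} → E a b → E b a → ⊥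
  ∈-asym {a} {b} ab ba with pairing a b
  ... | p , hp = no-∈-minimal-member (proj₂ (hp a) (inj₁ refl)) pred
    where
    pred : ∀ m → E m p → Σ M λ y → E y m × E y p
    pred m mp with proj₁ (hp m) mp
    ... | inj₁ refl = b , ba , proj₂ (hp b) (inj₂ refl)
    ... | inj₂ refl = a , ab , proj₂ (hp a) (inj₁ refl)

  ∈-irrefl : ∀ a → ¬ E a a
  ∈-irrefl a aa = ∈-asym aa aa

  no-∈-3-cycle : ∀ {a b c} → E a b → E b c → E c a → ⊥
  no-∈-3-cycle {a} {b} {c} ab bc ca with pairing a b
  ... | p , hp with adjoin p c
  ... | t , ht = no-∈-minimal-member (a∈t) pred
    where
    a∈t : E a t
    a∈t = proj₂ (ht a) (inj₁ (proj₂ (hp a) (inj₁ refl)))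
    b∈t : E b t
    b∈t = proj₂ (ht b) (inj₁ (proj₂ (hp b) (inj₂ refl)))
    c∈t : E c t
    c∈t = proj₂ (ht c) (inj₂ refl)
    pred : ∀ m → E m t → Σ M λ y → E y m × E y t
    pred m mt with proj₁ (ht m) mt
    ... | inj₂ refl = b , bc , b∈t
    ... | inj₁ mp with proj₁ (hp m) mp
    ... | inj₁ refl = c , ca , c∈t
    ... | inj₂ refl = a , ab , a∈t

  IsKPair : M → M → M → Set
  IsKPair p x v = ∀ z → E z p ↔ (IsSingleton z x ⊎ IsUPair z x v)

  kpair : ∀ x v → Σ M λ p → IsKPair p x v
  kpair x v with singleton x | pairing x v
  ... | s , hs | u , hu with pairing s u
  ... | p , hp = p , λ z → to z , from z
    where
    to : ∀ z → E z p → IsSingleton z x ⊎ IsUPair z x v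
    to z zp with proj₁ (hp z) zp
    ... | inj₁ refl = inj₁ hs
    ... | inj₂ refl = inj₂ hu
    from : ∀ z → IsSingleton z x ⊎ IsUPair z x v → E z p
    from z (inj₁ h) = proj₂ (hp z) (inj₁ (same-members h hs))
    from z (inj₂ h) = proj₂ (hp z) (inj₂ (same-members h hu))

  kpair-injectiveˡ : ∀ {p x v x′ v′} → IsKPair p x v → IsKPair p x′ v′ → x ≡ x′
  kpair-injectiveˡ {p} {x} {v} {x′} h h′ with singleton x
  ... | s , hs with proj₁ (h′ s) (proj₂ (h s) (inj₁ hs))
  ... | inj₁ g = proj₁ (g x) (proj₂ (hs x) refl)
  ... | inj₂ g = sym (proj₁ (hs x′) (proj₂ (g x′) (inj₁ refl)))

  kpair-injectiveʳ : ∀ {p x v v′} → IsKPair p x v → IsKPair p x v′ → v ≡ v′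
  kpair-injectiveʳ {p} {x} {v} {v′} h h′ with pairing x v | pairing x v′
  ... | s , hs | s′ , hs′ = combine (second-of h h′ hs) (second-of h′ h hs′)
    where
    -- {x, a} ∈ p, and p also codes ⟨x, b⟩, so {x, a} is {x} or {x, b}.
    second-of : ∀ {a b t} → IsKPair p x a → IsKPair p x b → IsUPair t x a → a ≡ x ⊎ a ≡ b
    second-of {a} {b} {t} ha hb ht with proj₁ (hb t) (proj₂ (ha t) (inj₂ ht))
    ... | inj₁ g = inj₁ (proj₁ (g a) (proj₂ (ht a) (inj₂ refl)))
    ... | inj₂ g = proj₁ (g a) (proj₂ (ht a) (inj₂ refl))
    combine : v ≡ x ⊎ v ≡ v′ → v′ ≡ x ⊎ v′ ≡ v → v ≡ v′
    combine (inj₂ e) _ = e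
    combine (inj₁ _) (inj₂ e) = sym e
    combine (inj₁ e) (inj₁ e′) = trans e (sym e′)

  IsOrd-∈ : ∀ {α x} → IsOrd E α → E x α → IsOrd E x
  IsOrd-∈ {α} {x} (tα , lα) xα = tr , λ y z yx zx → lα y z (tα x y xα yx) (tα x z xα zx)
    where
    tr : ∀ w z → E w x → E z w → E z x
    tr w z wx zw with lα z x (tα w z (tα x w xα wx) zw) xα
    ... | inj₁ zx = zx
    ... | inj₂ (inj₁ refl) = ⊥-elim (∈-asym zw wx)
    ... | inj₂ (inj₂ xz) = ⊥-elim (no-∈-3-cycle xz zw wx)

module ZFOrdinals {M : Set} {E : M → M → Set} (em : ExcludedMiddle 0ℓ) (zf : ZF M E) where
  open ZF zf
  open ZFBasics zf

  private
    dne : {P : Set} → ¬ ¬ P → P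
    dne = em⇒dne em

  -- X is the least element of δ outside X, found by foundation.
  IsOrd-transitive-subset : ∀ {δ X} → IsOrd E δ → X ⊆ δ → IsTransitiveSet X → X ≡ δ ⊎ E X δ
  IsOrd-transitive-subset {δ} {X} (tδ , lδ) X⊆δ trX with em {Σ M λ x → E x δ × ¬ E x X}
  ... | no δ⊆X = inj₁ (⊆-antisym X⊆δ λ z zδ → dne λ zX → δ⊆X (z , zδ , zX))
  ... | yes (x , xδ , xX) with separation (¬' (0 ∈' 12)) _ (λ _ → X) δ
  ... | b , hb with ∈-minimal b (λ y → E y δ × ¬ E y X) hb x (xδ , xX)
  ... | μ , (μδ , μX) , below = inj₂ (subst (λ t → E t δ) μ≡X μδ)
    where
    X⊆μ : ∀ z → E z X → E z μ
    X⊆μ z zX with lδ z μ (X⊆δ z zX) μδ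
    ... | inj₁ zμ = zμ
    ... | inj₂ (inj₁ refl) = ⊥-elim (μX zX)
    ... | inj₂ (inj₂ μz) = ⊥-elim (μX (trX z μ zX μz))
    μ≡X : μ ≡ X
    μ≡X = ⊆-antisym (λ z zμ → dne λ zX → below z zμ (tδ μ z μδ zμ , zX)) X⊆μ

  -- α ∩ β is a transitive subset of both α and β.
  IsOrd-trichotomy : ∀ {α β} → IsOrd E α → IsOrd E β → E α β ⊎ α ≡ β ⊎ E β α
  IsOrd-trichotomy {α} {β} oα oβ with separation (0 ∈' 12) _ (λ _ → β) α
  ... | γ , hγ = compare (IsOrd-transitive-subset oα (λ z zγ → proj₁ (proj₁ (hγ z) zγ)) trγ)
                         (IsOrd-transitive-subset oβ (λ z zγ → proj₂ (proj₁ (hγ z) zγ)) trγ)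
    where
    trγ : IsTransitiveSet γ
    trγ y z yγ zy with proj₁ (hγ y) yγ
    ... | yα , yβ = proj₂ (hγ z) (proj₁ oα y z yα zy , proj₁ oβ y z yβ zy)
    compare : γ ≡ α ⊎ E γ α → γ ≡ β ⊎ E γ β → E α β ⊎ α ≡ β ⊎ E β α
    compare (inj₁ refl) (inj₁ refl) = inj₂ (inj₁ refl)
    compare (inj₁ refl) (inj₂ γβ) = inj₁ γβ
    compare (inj₂ γα) (inj₁ refl) = inj₂ (inj₂ γα)
    compare (inj₂ γα) (inj₂ γβ) = ⊥-elim (∈-irrefl γ (proj₂ (hγ γ) (γα , γβ)))

-- Recursion on ∈ inside the model: the function F on A with F x = c ∪ ⋃ { R(F y) : y ∈ x ∩ A },
-- for R defined by φR (argument 20, value 21). An attempt is a set of pairs ⟨x, F x⟩ with x ∈ A,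
-- closed downwards in A and satisfying this equation; the graph H of F is the union of all attempts.
module ∈-Recursion {M : Set} {E : M → M → Set} (em : ExcludedMiddle 0ℓ) (zf : ZF M E)
    (A c : M) (φR : Formula) (φR-pure : NoS φR) (R : M → M → Set)
    (sat-φR : ∀ ρ → Sat∈ E ρ φR ↔ R (ρ 20) (ρ 21))
    (R-total : ∀ u → Σ M (R u)) (R-functional : ∀ {u w w′} → R u w → R u w′ → w ≡ w′) where
  open ZF zf
  open ZFBasics zf

  private
    dne : {P : Set} → ¬ ¬ P → P
    dne = em⇒dne em

  StepPredicate : Set₁
  StepPredicate = M → M → M → M → M → Set

  -- The condition "R u w" is abstracted to Step z y u q w so that
  -- satisfaction of valueFormula, where it reads "φR holds in the environment z y u q w", has this shape.
  ValueMember : StepPredicate → M → M → M → M → M → Set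
  ValueMember Step a b F x z =
    E z b ⊎ Σ M λ y → (E y x × E y a) × Σ M λ u → Σ M λ q → (E q F × IsKPair q y u) × Σ M λ w → Step z y u q w × E z w

  ValueMember-map : ∀ {S S′ a b F x z} → (∀ z y u q w → S z y u q w → S′ z y u q w) →
                    ValueMember S a b F x z → ValueMember S′ a b F x z
  ValueMember-map f (inj₁ zb) = inj₁ zb
  ValueMember-map f (inj₂ (y , yxa , u , q , qF , w , s , zw)) = inj₂ (y , yxa , u , q , qF , w , f _ y u q w s , zw)

  ValueVia : StepPredicate → M → M → M → M → M → Set
  ValueVia Step a b F x v = ∀ z → E z v ↔ ValueMember Step a b F x z

  ValueVia-map : ∀ {S S′ a b F x v} → (∀ z y u q w → S z y u q w ↔ S′ z y u q w) →
                 ValueVia S a b F x v → ValueVia S′ a b F x v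
  ValueVia-map S↔S′ val z = (λ zv → ValueMember-map (λ z y u q w → proj₁ (S↔S′ z y u q w)) (proj₁ (val z) zv)) ,
                            (λ zm → proj₂ (val z) (ValueMember-map (λ z y u q w → proj₂ (S↔S′ z y u q w)) zm))

  AttemptVia : (M → M → M → Set) → M → M → Set
  AttemptVia Value a F =
    (∀ p → E p F → Σ M λ x → Σ M λ v → IsKPair p x v × (E x a × Value p x v)) ×
    ((∀ p q x v v′ → E p F → E q F → IsKPair p x v → IsKPair q x v′ → v ≡ v′) ×
     (∀ p x v y → E p F → IsKPair p x v → E y x → E y a → Σ M λ q → Σ M λ u → E q F × IsKPair q y u))

  AttemptVia-map : ∀ {V V′ a F} → (∀ {p x v} → V p x v → V′ p x v) → AttemptVia V a F → AttemptVia V′ a F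
  AttemptVia-map f (pairs , functional , closed) = (λ p pF → map₂ (map₂ (map₂ (map₂ f))) (pairs p pF)) , functional , closed

  RStep : StepPredicate
  RStep _ _ u _ w = R u w

  -- Variables: 10 = a, 11 = b, 60 = F, 51 = x, 52 = v.
  valueFormula : Formula
  valueFormula =
    ∀' 40 ((40 ∈' 52) ⇔' ((40 ∈' 11) ∨' ∃' 41 (((41 ∈' 51) ∧' (41 ∈' 10)) ∧'
      ∃' 20 (∃' 42 (((42 ∈' 60) ∧' kpairFormula 42 41 20) ∧' ∃' 21 (φR ∧' (40 ∈' 21)))))))

  attemptFormula : Formula
  attemptFormula =
    ∀' 50 ((50 ∈' 60) ⇒' ∃' 51 (∃' 52 (kpairFormula 50 51 52 ∧' ((51 ∈' 10) ∧' valueFormula)))) ∧'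
    (∀' 50 (∀' 53 (∀' 51 (∀' 52 (∀' 54 ((50 ∈' 60) ⇒' ((53 ∈' 60) ⇒'
       (kpairFormula 50 51 52 ⇒' (kpairFormula 53 51 54 ⇒' (52 ≐ 54))))))))) ∧'
     ∀' 50 (∀' 51 (∀' 52 (∀' 55 ((50 ∈' 60) ⇒' (kpairFormula 50 51 52 ⇒' ((55 ∈' 51) ⇒' ((55 ∈' 10) ⇒'
       ∃' 53 (∃' 56 ((53 ∈' 60) ∧' kpairFormula 53 55 56))))))))))

  valueFormula-pure : NoS valueFormula
  valueFormula-pure = (_ , inner) , (inner , _)
    where
    inner : NoS ((40 ∈' 11) ∨' ∃' 41 (((41 ∈' 51) ∧' (41 ∈' 10)) ∧'
              ∃' 20 (∃' 42 (((42 ∈' 60) ∧' kpairFormula 42 41 20) ∧' ∃' 21 (φR ∧' (40 ∈' 21))))))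
    inner = _ , _ , _ , φR-pure , _

  attemptFormula-pure : NoS attemptFormula
  attemptFormula-pure = (_ , _ , _ , valueFormula-pure) , _

  sat-valueFormula : ∀ ρ → Sat∈ E ρ valueFormula ↔ ValueVia RStep (ρ 10) (ρ 11) (ρ 60) (ρ 51) (ρ 52)
  sat-valueFormula ρ = ValueVia-map (λ z y u q w → sat-φR (env z y u q w)) ,
                       ValueVia-map (λ z y u q w → swap (sat-φR (env z y u q w)))
    where
    env : M → M → M → M → M → ℕ → M
    env z y u q w = ((((ρ [ 40 ↦ z ]) [ 41 ↦ y ]) [ 20 ↦ u ]) [ 42 ↦ q ]) [ 21 ↦ w ]
    swap : ∀ {P Q : Set} → P ↔ Q → Q ↔ P
    swap (f , g) = g , f

  sat-attemptFormula : ∀ ρ → Sat∈ E ρ attemptFormula ↔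
                       AttemptVia (λ _ x v → ValueVia RStep (ρ 10) (ρ 11) (ρ 60) x v) (ρ 10) (ρ 60)
  sat-attemptFormula ρ = AttemptVia-map (λ {p} {x} {v} → proj₁ (sat-valueFormula (env p x v))) ,
                         AttemptVia-map (λ {p} {x} {v} → proj₂ (sat-valueFormula (env p x v)))
    where
    env : M → M → M → ℕ → M
    env p x v = ((ρ [ 50 ↦ p ]) [ 51 ↦ x ]) [ 52 ↦ v ]

  IsValue : M → M → M → Set
  IsValue F x v = ValueVia RStep A c F x v

  IsAttempt : M → Set
  IsAttempt F = AttemptVia (λ _ x v → IsValue F x v) A F

  attempt-domain : ∀ {F p x v} → IsAttempt F → E p F → IsKPair p x v → E x A
  attempt-domain att pF hp with proj₁ att _ pF
  ... | _ , _ , hp₁ , x₁∈A , _ with kpair-injectiveˡ hp₁ hp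
  ... | refl = x₁∈A

  attempt-value : ∀ {F p x v} → IsAttempt F → E p F → IsKPair p x v → IsValue F x v
  attempt-value att pF hp with proj₁ att _ pF
  ... | _ , _ , hp₁ , _ , value with kpair-injectiveˡ hp₁ hp
  ... | refl with kpair-injectiveʳ hp₁ hp
  ... | refl = value

  attempt-functional : ∀ {F p q x v v′} → IsAttempt F → E p F → E q F → IsKPair p x v → IsKPair q x v′ → v ≡ v′
  attempt-functional att = proj₁ (proj₂ att) _ _ _ _ _

  attempt-closed : ∀ {F p x v y} → IsAttempt F → E p F → IsKPair p x v → E y x → E y A →
                   Σ M λ q → Σ M λ u → E q F × IsKPair q y u
  attempt-closed att = proj₂ (proj₂ att) _ _ _ _

  AgreeAt : M → M → M → Set
  AgreeAt F G y = ∀ {q q′ u u′} → E q F → E q′ G → IsKPair q y u → IsKPair q′ y u′ → u ≡ u′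

  value-transport : ∀ {F K x v} → F ⊆ K → (∀ {y} → AgreeAt K F y) →
                    (∀ y → E y x → E y A → Σ M λ q → Σ M λ u → E q F × IsKPair q y u) →
                    IsValue F x v → IsValue K x v
  value-transport {F} {K} {x} {v} F⊆K agree defined value z = to , from
    where
    to : E z v → ValueMember RStep A c K x z
    to zv with proj₁ (value z) zv
    ... | inj₁ zc = inj₁ zc
    ... | inj₂ (y , yxA , u , q , (qF , hq) , rest) = inj₂ (y , yxA , u , q , (F⊆K q qF , hq) , rest)
    from : ValueMember RStep A c K x z → E z v
    from (inj₁ zc) = proj₂ (value z) (inj₁ zc)
    from (inj₂ (y , (yx , yA) , u , q , (qK , hq) , rest)) with defined y yx yA
    ... | q′ , u′ , q′F , hq′ with agree qK q′F hq hq′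
    ... | refl = proj₂ (value z) (inj₂ (y , (yx , yA) , u , q′ , (q′F , hq′) , rest))

  value-⊆ : ∀ {F G p q m v v′} → IsAttempt F → IsAttempt G → E p F → E q G → IsKPair p m v → IsKPair q m v′ →
            (∀ y → E y m → E y A → AgreeAt F G y) → v ⊆ v′
  value-⊆ attF attG pF qG hp hq agree z zv with proj₁ (attempt-value attF pF hp z) zv
  ... | inj₁ zc = proj₂ (attempt-value attG qG hq z) (inj₁ zc)
  ... | inj₂ (y , (ym , yA) , u , q₁ , (q₁F , hq₁) , rest) with attempt-closed attG qG hq ym yA
  ... | q₂ , u₂ , q₂G , hq₂ with agree y ym yA q₁F q₂G hq₁ hq₂
  ... | refl = proj₂ (attempt-value attG qG hq z) (inj₂ (y , (ym , yA) , u , q₂ , (q₂G , hq₂) , rest))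

  Disagree : M → M → M → Set
  Disagree F G x = E x A × Σ M λ p → Σ M λ q → Σ M λ v → Σ M λ v′ →
                   E p F × (E q G × (IsKPair p x v × (IsKPair q x v′ × ¬ v ≡ v′)))

  disagreeFormula : Formula
  disagreeFormula = ∃' 63 (∃' 64 (∃' 65 (∃' 66 ((63 ∈' 12) ∧' ((64 ∈' 13) ∧'
                      (kpairFormula 63 0 65 ∧' (kpairFormula 64 0 66 ∧' (¬' (65 ≐ 66)))))))))

  -- A minimal point of disagreement has the same value in F and G, computed from agreeing values below it.
  attempts-agree : ∀ {F G p q x v v′} → IsAttempt F → IsAttempt G → E p F → E q G →
                   IsKPair p x v → IsKPair q x v′ → v ≡ v′
  attempts-agree {F} {G} {p} {q} {x} {v} {v′} attF attG pF qG hp hq = dne λ v≢v′ →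
    ∈-induction (proj₁ disagreements) (Disagree F G) (proj₂ disagreements) no-minimal x
      (attempt-domain attF pF hp , p , q , v , v′ , pF , qG , hp , hq , v≢v′)
    where
    disagreements : Σ M λ b → ∀ y → E y b ↔ Disagree F G y
    disagreements = separation disagreeFormula _ (((λ _ → A) [ 12 ↦ F ]) [ 13 ↦ G ]) A
    no-minimal : ∀ m → (∀ y → E y m → ¬ Disagree F G y) → ¬ Disagree F G m
    no-minimal m below (_ , _ , _ , _ , _ , p₀F , q₀G , hp₀ , hq₀ , v₀≢v₀′) =
      v₀≢v₀′ (⊆-antisym (value-⊆ attF attG p₀F q₀G hp₀ hq₀ agreeFG) (value-⊆ attG attF q₀G p₀F hq₀ hp₀ agreeGF))
      where
      agreeFG : ∀ y → E y m → E y A → AgreeAt F G y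
      agreeFG y ym yA q₁F q₂G h₁ h₂ = dne λ ne → below y ym (yA , _ , _ , _ , _ , q₁F , q₂G , h₁ , h₂ , ne)
      agreeGF : ∀ y → E y m → E y A → AgreeAt G F y
      agreeGF y ym yA q₁G q₂F h₁ h₂ = sym (agreeFG y ym yA q₂F q₁G h₂ h₁)

  ρA : ℕ → M
  ρA = (λ _ → A) [ 11 ↦ c ]

  domainFormula : Formula
  domainFormula = ∃' 60 (∃' 61 (∃' 62 (attemptFormula ∧' ((61 ∈' 60) ∧' kpairFormula 61 0 62))))

  domain : Σ M λ D → ∀ x → E x D ↔ (E x A × Sat∈ E (ρA [ 0 ↦ x ]) domainFormula)
  domain = separation domainFormula (attemptFormula-pure , _) ρA A

  D : M
  D = proj₁ domain

  D-intro : ∀ {F p x v} → IsAttempt F → E p F → IsKPair p x v → E x D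
  D-intro {F} {p} {x} {v} att pF hp = proj₂ (proj₂ domain x)
    (attempt-domain att pF hp , F , p , v ,
     proj₂ (sat-attemptFormula ((((ρA [ 0 ↦ x ]) [ 60 ↦ F ]) [ 61 ↦ p ]) [ 62 ↦ v ])) att , pF , hp)

  D-elim : ∀ {x} → E x D → Σ M λ F → Σ M λ p → Σ M λ v → IsAttempt F × (E p F × IsKPair p x v)
  D-elim {x} xD with proj₁ (proj₂ domain x) xD
  ... | _ , F , p , v , att , pF , hp = F , p , v , proj₁ (sat-attemptFormula _) att , pF , hp

  -- H is the union of all attempts, collected by Replacement as the pairs ⟨x, v⟩ with x ∈ D.
  graphFormula : Formula
  graphFormula = ∃' 60 (∃' 62 (attemptFormula ∧' ((1 ∈' 60) ∧' kpairFormula 1 0 62)))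

  graph : Σ M λ H → ∀ q → E q H ↔ Σ M (λ x → E x D × Sat∈ E ((ρA [ 0 ↦ x ]) [ 1 ↦ q ]) graphFormula)
  graph = replacement graphFormula (attemptFormula-pure , _) ρA D pair-of
    where
    pair-of : ∀ x → E x D → Σ M λ q → Sat∈ E ((ρA [ 0 ↦ x ]) [ 1 ↦ q ]) graphFormula ×
              (∀ q′ → Sat∈ E ((ρA [ 0 ↦ x ]) [ 1 ↦ q′ ]) graphFormula → q′ ≡ q)
    pair-of x xD with D-elim xD
    ... | F , p , v , att , pF , hp =
      p , (F , v , proj₂ (sat-attemptFormula ((((ρA [ 0 ↦ x ]) [ 1 ↦ p ]) [ 60 ↦ F ]) [ 62 ↦ v ])) att , pF , hp) ,
      λ { q′ (F′ , v′ , att′ , q′F′ , hq′) → unique (proj₁ (sat-attemptFormula _) att′) q′F′ hq′ }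
      where
      unique : ∀ {F′ q′ v′} → IsAttempt F′ → E q′ F′ → IsKPair q′ x v′ → q′ ≡ p
      unique att′ q′F′ hq′ with attempts-agree att′ att q′F′ pF hq′ hp
      ... | refl = same-members hq′ hp

  H : M
  H = proj₁ graph

  attempt-⊆-H : ∀ {F} → IsAttempt F → F ⊆ H
  attempt-⊆-H {F} att p pF =
    let (x , v , hp , _) = proj₁ att p pF
    in proj₂ (proj₂ graph p)
         (x , D-intro att pF hp , F , v ,
          proj₂ (sat-attemptFormula ((((ρA [ 0 ↦ x ]) [ 1 ↦ p ]) [ 60 ↦ F ]) [ 62 ↦ v ])) att , pF , hp)

  H-elim : ∀ {q} → E q H → Σ M λ F → IsAttempt F × E q F
  H-elim {q} qH =
    let (_ , _ , F , _ , att , qF , _) = proj₁ (proj₂ graph q) qH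
    in F , proj₁ (sat-attemptFormula _) att , qF

  H-attempt : IsAttempt H
  H-attempt = pairs , functional , closed
    where
    H-agrees : ∀ {F y} → IsAttempt F → AgreeAt H F y
    H-agrees att qH q′F hq hq′ = let (_ , att₁ , qF₁) = H-elim qH in attempts-agree att₁ att qF₁ q′F hq hq′
    pairs : ∀ p → E p H → Σ M λ x → Σ M λ v → IsKPair p x v × (E x A × IsValue H x v)
    pairs p pH =
      let (F , att , pF) = H-elim pH
          (x , v , hp , xA , value) = proj₁ att p pF
      in x , v , hp , xA ,
         value-transport (attempt-⊆-H att) (H-agrees att)
                         (λ y yx yA → attempt-closed att pF hp yx yA) value
    functional : ∀ p q x v v′ → E p H → E q H → IsKPair p x v → IsKPair q x v′ → v ≡ v′
    functional p q x v v′ pH qH hp hq =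
      let (_ , attF , pF) = H-elim pH
          (_ , attG , qG) = H-elim qH
      in attempts-agree attF attG pF qG hp hq
    closed : ∀ p x v y → E p H → IsKPair p x v → E y x → E y A → Σ M λ q → Σ M λ u → E q H × IsKPair q y u
    closed p x v y pH hp yx yA =
      let (_ , att , pF) = H-elim pH
          (q , u , qF , hq) = attempt-closed att pF hp yx yA
      in q , u , attempt-⊆-H att q qF , hq

  H-domain : ∀ {q y u} → E q H → IsKPair q y u → E y D
  H-domain qH hq = let (_ , att , qF) = H-elim qH in D-intro att qF hq

  D-in-H : ∀ {y} → E y D → Σ M λ q → Σ M λ u → E q H × IsKPair q y u
  D-in-H yD = let (_ , p , v , att , pF , hp) = D-elim yD in p , v , attempt-⊆-H att p pF , hp

  ρH : ℕ → M
  ρH = ρA [ 12 ↦ H ]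

  -- Variables: 0 = y, 1 = w; says w = R(H(y)).
  imageFormula : Formula
  imageFormula = ∃' 20 (∃' 21 ((∃' 63 ((63 ∈' 12) ∧' kpairFormula 63 0 20)) ∧' (φR ∧' (21 ≐ 1))))

  module Extension (m : M) (m∈A : E m A) (m∉D : ¬ E m D) (below-D : ∀ y → E y m → E y A → E y D) where

    m∩A : Σ M λ b → ∀ y → E y b ↔ (E y m × E y A)
    m∩A = separation (0 ∈' 10) _ ρA m

    images : Σ M λ W → ∀ w → E w W ↔ Σ M (λ y → E y (proj₁ m∩A) × Sat∈ E ((ρH [ 0 ↦ y ]) [ 1 ↦ w ]) imageFormula)
    images = replacement imageFormula (_ , φR-pure , _) ρH (proj₁ m∩A) image-of
      where
      image-of : ∀ y → E y (proj₁ m∩A) → Σ M λ w → Sat∈ E ((ρH [ 0 ↦ y ]) [ 1 ↦ w ]) imageFormula ×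
                 (∀ w′ → Sat∈ E ((ρH [ 0 ↦ y ]) [ 1 ↦ w′ ]) imageFormula → w′ ≡ w)
      image-of y y∈m∩A =
        let (ym , yA) = proj₁ (proj₂ m∩A y) y∈m∩A
            (q , u , qH , hq) = D-in-H (below-D y ym yA)
            (w , r) = R-total u
        in w , (u , w , (q , qH , hq) , proj₂ (sat-φR ((((ρH [ 0 ↦ y ]) [ 1 ↦ w ]) [ 20 ↦ u ]) [ 21 ↦ w ])) r , refl) ,
           λ { w′ (u′ , w″ , (q′ , q′H , hq′) , r′ , w″≡w′) →
                 trans (sym w″≡w′)
                   (R-functional (subst (λ t → R t w″) (attempt-functional H-attempt q′H qH hq′ hq) (proj₁ (sat-φR _) r′)) r) }

    ⋃images : Σ M λ U → ∀ z → E z U ↔ Σ M (λ w → E w (proj₁ images) × E z w)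
    ⋃images = union (proj₁ images)

    value : Σ M λ v → ∀ z → E z v ↔ (E z c ⊎ E z (proj₁ ⋃images))
    value = union₂ c (proj₁ ⋃images)

    v : M
    v = proj₁ value

    v-value : IsValue H m v
    v-value z = (λ zv → to (proj₁ (proj₂ value z) zv)) , from
      where
      to : E z c ⊎ E z (proj₁ ⋃images) → ValueMember RStep A c H m z
      to (inj₁ zc) = inj₁ zc
      to (inj₂ z∈⋃) =
        let (w , wW , zw) = proj₁ (proj₂ ⋃images z) z∈⋃
            (y , y∈m∩A , u , w′ , (q , qH , hq) , r , w′≡w) = proj₁ (proj₂ images w) wW
        in inj₂ (y , proj₁ (proj₂ m∩A y) y∈m∩A , u , q , (qH , hq) , w′ , proj₁ (sat-φR _) r , subst (E z) (sym w′≡w) zw)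
      from : ValueMember RStep A c H m z → E z v
      from (inj₁ zc) = proj₂ (proj₂ value z) (inj₁ zc)
      from (inj₂ (y , (ym , yA) , u , q , (qH , hq) , w , r , zw)) =
        proj₂ (proj₂ value z) (inj₂ (proj₂ (proj₂ ⋃images z)
          (w , proj₂ (proj₂ images w)
                 (y , proj₂ (proj₂ m∩A y) (ym , yA) , u , w , (q , qH , hq) ,
                  proj₂ (sat-φR ((((ρH [ 0 ↦ y ]) [ 1 ↦ w ]) [ 20 ↦ u ]) [ 21 ↦ w ])) r , refl) , zw)))

    p₀ : M
    p₀ = proj₁ (kpair m v)

    hp₀ : IsKPair p₀ m v
    hp₀ = proj₂ (kpair m v)

    H′ : Σ M λ H′ → ∀ q → E q H′ ↔ (E q H ⊎ q ≡ p₀)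
    H′ = adjoin H p₀

    H⊆H′ : H ⊆ proj₁ H′
    H⊆H′ q qH = proj₂ (proj₂ H′ q) (inj₁ qH)

    p₀∈H′ : E p₀ (proj₁ H′)
    p₀∈H′ = proj₂ (proj₂ H′ p₀) (inj₂ refl)

    H′-elim : ∀ {q} → E q (proj₁ H′) → E q H ⊎ q ≡ p₀
    H′-elim {q} = proj₁ (proj₂ H′ q)

    p₀-agrees-H : ∀ {y u q′ u′} → IsKPair p₀ y u → E q′ H → IsKPair q′ y u′ → u ≡ u′
    p₀-agrees-H hp q′H hq′ = ⊥-elim (m∉D (subst (λ t → E t D) (sym (kpair-injectiveˡ hp₀ hp)) (H-domain q′H hq′)))

    H′-agrees-H : ∀ {y} → AgreeAt (proj₁ H′) H y
    H′-agrees-H {y} {u = u} {u′} qH′ q′H hq hq′ = cases (H′-elim qH′) hq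
      where
      cases : ∀ {q} → E q H ⊎ q ≡ p₀ → IsKPair q y u → u ≡ u′
      cases (inj₁ qH) hq = attempt-functional H-attempt qH q′H hq hq′
      cases (inj₂ refl) hq = p₀-agrees-H hq q′H hq′

    H′-attempt : IsAttempt (proj₁ H′)
    H′-attempt = (λ p pH′ → pairs (H′-elim pH′)) ,
                 (λ p q x v₁ v₂ pH′ qH′ hp hq → functional (H′-elim pH′) (H′-elim qH′) hp hq) ,
                 (λ p x v₁ y pH′ hp yx yA → closed (H′-elim pH′) hp yx yA)
      where
      pairs : ∀ {p} → E p H ⊎ p ≡ p₀ → Σ M λ x → Σ M λ v → IsKPair p x v × (E x A × IsValue (proj₁ H′) x v)
      pairs {p} (inj₁ pH) =
        let (x , v , hp , xA , val) = proj₁ H-attempt p pH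
        in x , v , hp , xA , value-transport H⊆H′ H′-agrees-H (λ y yx yA → attempt-closed H-attempt pH hp yx yA) val
      pairs (inj₂ refl) = m , v , hp₀ , m∈A , value-transport H⊆H′ H′-agrees-H (λ y ym yA → D-in-H (below-D y ym yA)) v-value
      functional : ∀ {p q x v₁ v₂} → E p H ⊎ p ≡ p₀ → E q H ⊎ q ≡ p₀ → IsKPair p x v₁ → IsKPair q x v₂ → v₁ ≡ v₂
      functional (inj₁ pH) (inj₁ qH) hp hq = attempt-functional H-attempt pH qH hp hq
      functional (inj₁ pH) (inj₂ refl) hp hq = sym (p₀-agrees-H hq pH hp)
      functional (inj₂ refl) (inj₁ qH) hp hq = p₀-agrees-H hp qH hq
      functional (inj₂ refl) (inj₂ refl) hp hq = kpair-injectiveʳ hp hq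
      closed : ∀ {p x v₁ y} → E p H ⊎ p ≡ p₀ → IsKPair p x v₁ → E y x → E y A →
               Σ M λ q → Σ M λ u → E q (proj₁ H′) × IsKPair q y u
      closed (inj₁ pH) hp yx yA =
        let (q , u , qH , hq) = attempt-closed H-attempt pH hp yx yA in q , u , H⊆H′ q qH , hq
      closed {y = y} (inj₂ refl) hp yx yA =
        let (q , u , qH , hq) = D-in-H (below-D y (subst (E y) (sym (kpair-injectiveˡ hp₀ hp)) yx) yA)
        in q , u , H⊆H′ q qH , hq

    absurd : ⊥
    absurd = m∉D (D-intro H′-attempt p₀∈H′ hp₀)

  -- An ∈-minimal element of A outside D would extend H by one more pair.
  A⊆D : A ⊆ D
  A⊆D x xA = dne λ x∉D →
    ∈-induction (proj₁ undefined) (λ y → E y A × ¬ E y D) (proj₂ undefined) no-minimal x (xA , x∉D)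
    where
    undefined : Σ M λ b → ∀ y → E y b ↔ (E y A × ¬ E y D)
    undefined = separation (¬' (0 ∈' 13)) _ (λ _ → D) A
    no-minimal : ∀ m → (∀ y → E y m → ¬ (E y A × ¬ E y D)) → ¬ (E m A × ¬ E m D)
    no-minimal m below (mA , m∉D) = Extension.absurd m mA m∉D (λ y ym yA → dne λ y∉D → below y ym (yA , y∉D))

  infix 4 _⟼_

  _⟼_ : M → M → Set
  x ⟼ v = Σ M λ p → E p H × IsKPair p x v

  ⟼-total : ∀ {x} → E x A → Σ M (x ⟼_)
  ⟼-total {x} xA = let (p , v , pH , hp) = D-in-H (A⊆D x xA) in v , p , pH , hp

  ⟼-functional : ∀ {x v v′} → x ⟼ v → x ⟼ v′ → v ≡ v′
  ⟼-functional (_ , pH , hp) (_ , qH , hq) = attempt-functional H-attempt pH qH hp hq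

  ⟼-∋-base : ∀ {x v z} → x ⟼ v → E z c → E z v
  ⟼-∋-base {z = z} (_ , pH , hp) zc = proj₂ (attempt-value H-attempt pH hp z) (inj₁ zc)

  ⟼-∋-step : ∀ {x v y u w z} → x ⟼ v → E y x → E y A → y ⟼ u → R u w → E z w → E z v
  ⟼-∋-step {y = y} {u} {w} {z} (_ , pH , hp) yx yA (q , qH , hq) r zw =
    proj₂ (attempt-value H-attempt pH hp z) (inj₂ (y , (yx , yA) , u , q , (qH , hq) , w , r , zw))

  ⟼-∈-cases : ∀ {x v z} → x ⟼ v → E z v →
              E z c ⊎ Σ M λ y → (E y x × E y A) × Σ M λ u → y ⟼ u × Σ M λ w → R u w × E z w
  ⟼-∈-cases {x} {z = z} (_ , pH , hp) zv = cases (proj₁ (attempt-value H-attempt pH hp z) zv)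
    where
    cases : ValueMember RStep A c H x z → E z c ⊎ Σ M λ y → (E y x × E y A) × Σ M λ u → y ⟼ u × Σ M λ w → R u w × E z w
    cases (inj₁ zc) = inj₁ zc
    cases (inj₂ (y , yxA , u , q , (qH , hq) , w , r , zw)) = inj₂ (y , yxA , u , (q , qH , hq) , w , r , zw)

module NonstandardModel {M : Set} {E : M → M → Set} (em : ExcludedMiddle 0ℓ) (zf : ZF M E) where
  open ZF zf
  open ZFBasics zf
  open ZFOrdinals em zf

  private
    dne : {P : Set} → ¬ ¬ P → P
    dne = em⇒dne em

  ∅ : M
  ∅ = proj₁ (proj₁ (proj₂ infinity))

  ∅-empty : ∀ z → ¬ E z ∅
  ∅-empty = proj₂ (proj₂ (proj₁ (proj₂ infinity)))

  -- level n = a ∪ ⋃ { ⋃ (level k) : k ∈ n } for n ∈ ω, and T = ⋃ { level n : n ∈ ω }.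
  module TransitiveClosure (a : M) where

    ω : M
    ω = proj₁ infinity

    ∅∈ω : E ∅ ω
    ∅∈ω = proj₁ (proj₂ (proj₁ (proj₂ infinity)))

    ω-successor : ∀ {n} → E n ω → Σ M λ s → E s ω × (∀ z → E z s ↔ (E z n ⊎ z ≡ n))
    ω-successor = proj₂ (proj₂ infinity) _

    IsUnion : M → M → Set
    IsUnion u w = ∀ z → E z w ↔ Σ M (λ y → E y u × E z y)

    unionFormula : Formula
    unionFormula = ∀' 30 ((30 ∈' 21) ⇔' ∃' 31 ((31 ∈' 20) ∧' (30 ∈' 31)))

    module Levels = ∈-Recursion em zf ω a unionFormula _ IsUnion (λ ρ → (λ h → h) , (λ h → h)) union same-members
    open Levels using (_⟼_; ⟼-total; ⟼-functional; ⟼-∋-base; ⟼-∋-step)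

    levels : Σ M λ K → ∀ v → E v K ↔ Σ M (λ n → E n ω × n ⟼ v)
    levels = replacement (∃' 2 ((2 ∈' 12) ∧' kpairFormula 2 0 1)) _ (λ _ → Levels.H) ω
               λ n nω → let (v , n⟼v) = ⟼-total nω in v , n⟼v , λ v′ n⟼v′ → ⟼-functional n⟼v′ n⟼v

    T : Σ M λ T → ∀ z → E z T ↔ Σ M (λ v → E v (proj₁ levels) × E z v)
    T = union (proj₁ levels)

    level-⊆-T : ∀ {n v} → E n ω → n ⟼ v → v ⊆ proj₁ T
    level-⊆-T nω n⟼v z zv = proj₂ (proj₂ T z) (_ , proj₂ (proj₂ levels _) (_ , nω , n⟼v) , zv)

    a-⊆-T : a ⊆ proj₁ T
    a-⊆-T z za = let (v , ∅⟼v) = ⟼-total ∅∈ω in level-⊆-T ∅∈ω ∅⟼v z (⟼-∋-base ∅⟼v za)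

    -- The members of members of level n lie in level n + 1.
    T-transitive : IsTransitiveSet (proj₁ T)
    T-transitive y z yT zy =
      let (v , vK , yv) = proj₁ (proj₂ T y) yT
          (n , nω , n⟼v) = proj₁ (proj₂ levels v) vK
          (s , sω , hs) = ω-successor nω
          (v′ , s⟼v′) = ⟼-total sω
          (⋃v , h⋃v) = union v
      in level-⊆-T sω s⟼v′ z
           (⟼-∋-step s⟼v′ (proj₂ (hs n) (inj₂ refl)) nω n⟼v h⋃v (proj₂ (h⋃v z) (y , yv , zy)))

  transitive-superset : ∀ a → Σ M λ T → a ⊆ T × IsTransitiveSet T
  transitive-superset a = proj₁ T , a-⊆-T , T-transitive
    where open TransitiveClosure a

  -- rank x = ⋃ { rank y ∪ {rank y} : y ∈ x ∩ T }.
  module Rank (T : M) where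

    IsSucc : M → M → Set
    IsSucc u s = ∀ z → E z s ↔ (E z u ⊎ z ≡ u)

    succFormula : Formula
    succFormula = ∀' 30 ((30 ∈' 21) ⇔' ((30 ∈' 20) ∨' (30 ≐ 20)))

    module Ranks = ∈-Recursion em zf T ∅ succFormula _ IsSucc (λ ρ → (λ h → h) , (λ h → h)) (λ u → adjoin u u) same-members
    open Ranks using (_⟼_; ⟼-total) public
    open Ranks using (⟼-∋-step; ⟼-∈-cases)

    rank-mono : ∀ {x y u v} → E y x → E y T → x ⟼ v → y ⟼ u → E u v
    rank-mono {u = u} yx yT x⟼v y⟼u =
      let (s , hs) = adjoin u u in ⟼-∋-step x⟼v yx yT y⟼u hs (proj₂ (hs u) (inj₂ refl))

    IsOrd-≼ : ∀ {β u} → IsOrd E u → E β u ⊎ β ≡ u → IsOrd E β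
    IsOrd-≼ ou (inj₁ βu) = IsOrd-∈ ou βu
    IsOrd-≼ ou (inj₂ refl) = ou

    rank-isOrd-step : ∀ {x v} → x ⟼ v → (∀ {y u} → E y x → E y T → y ⟼ u → IsOrd E u) → IsOrd E v
    rank-isOrd-step {x} {v} x⟼v below = transitive , λ β β′ βv β′v → IsOrd-trichotomy (member-isOrd βv) (member-isOrd β′v)
      where
      successor-of-rank : ∀ {β} → E β v → Σ M λ u → IsOrd E u × (E β u ⊎ β ≡ u) × (∀ γ → E γ u ⊎ γ ≡ u → E γ v)
      successor-of-rank {β} βv = cases (⟼-∈-cases x⟼v βv)
        where
        cases : E β ∅ ⊎ Σ M (λ y → (E y x × E y T) × Σ M λ u → y ⟼ u × Σ M λ s → IsSucc u s × E β s) →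
                Σ M λ u → IsOrd E u × (E β u ⊎ β ≡ u) × (∀ γ → E γ u ⊎ γ ≡ u → E γ v)
        cases (inj₁ β∈∅) = ⊥-elim (∅-empty β β∈∅)
        cases (inj₂ (y , (yx , yT) , u , y⟼u , s , hs , βs)) =
          u , below yx yT y⟼u , proj₁ (hs β) βs , λ γ γ≼u → ⟼-∋-step x⟼v yx yT y⟼u hs (proj₂ (hs γ) γ≼u)
      member-isOrd : ∀ {β} → E β v → IsOrd E β
      member-isOrd βv = let (_ , ou , β≼u , _) = successor-of-rank βv in IsOrd-≼ ou β≼u
      transitive : ∀ β γ → E β v → E γ β → E γ v
      transitive β γ βv γβ = let (u , ou , β≼u , ≼u⊆v) = successor-of-rank βv in ≼u⊆v γ (inj₁ (lower ou β≼u))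
        where
        lower : ∀ {u} → IsOrd E u → E β u ⊎ β ≡ u → E γ u
        lower ou (inj₁ βu) = proj₁ ou β γ βu γβ
        lower ou (inj₂ refl) = γβ

    HasNonOrdinalRank : M → Set
    HasNonOrdinalRank y = E y T × Σ M λ p → Σ M λ u → E p Ranks.H × (IsKPair p y u × ¬ IsOrd E u)

    rank-isOrd : ∀ {x v} → E x T → x ⟼ v → IsOrd E v
    rank-isOrd {x} {v} xT (p , pH , hp) = dne λ ¬ord →
      ∈-induction (proj₁ bad) HasNonOrdinalRank (proj₂ bad) no-minimal x (xT , p , v , pH , hp , ¬ord)
      where
      bad : Σ M λ b → ∀ y → E y b ↔ HasNonOrdinalRank y
      bad = separation (∃' 2 (∃' 3 ((2 ∈' 12) ∧' (kpairFormula 2 0 3 ∧' (¬' isOrdFormula 3))))) _ (λ _ → Ranks.H) T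
      no-minimal : ∀ m → (∀ y → E y m → ¬ HasNonOrdinalRank y) → ¬ HasNonOrdinalRank m
      no-minimal m below (_ , q , u , qH , hq , ¬ord-u) =
        ¬ord-u (rank-isOrd-step (q , qH , hq) λ {y} {u′} ym yT (q′ , q′H , hq′) →
                  dne λ ¬ord′ → below y ym (yT , q′ , u′ , q′H , hq′ , ¬ord′))

  nonstandard-ordinal : NonStandard M E → Σ M λ δ → IsOrd E δ × ¬ InWF E δ
  nonstandard-ordinal (f , f-desc) = rank 0 , rank-isOrd (f∈T 0) (rank-spec 0) , λ wf → wf (rank , refl , rank-desc)
    where
    closure : Σ M λ T → f 0 ⊆ T × IsTransitiveSet T
    closure = transitive-superset (f 0)
    open Rank (proj₁ closure)
    f∈T : ∀ n → E (f (suc n)) (proj₁ closure)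
    f∈T zero = proj₁ (proj₂ closure) (f 1) (f-desc 0)
    f∈T (suc n) = proj₂ (proj₂ closure) (f (suc n)) (f (suc (suc n))) (f∈T n) (f-desc (suc n))
    rank : ℕ → M
    rank n = proj₁ (⟼-total (f∈T n))
    rank-spec : ∀ n → f (suc n) ⟼ rank n
    rank-spec n = proj₂ (⟼-total (f∈T n))
    rank-desc : Descending E rank
    rank-desc n = rank-mono (f-desc (suc n)) (f∈T (suc n)) (rank-spec n) (rank-spec (suc n))

  overspill : ∀ {δ X} (P : M → Set) → IsOrd E δ → ¬ InWF E δ → (∀ α → E α X ↔ (E α δ × P α)) →
              (∀ α → IsOrd E α → InWF E α → P α) → Σ M λ γ → E γ X × ¬ InWF E γ
  overspill {δ} {X} P oδ ¬wf-δ hX P-wf = dne λ none →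
    let members-wf : ∀ x → E x X → InWF E x
        members-wf x xX = dne λ ¬wf → none (x , xX , ¬wf)
        X-wf : InWF E X
        X-wf = members-InWF⇒InWF members-wf
    in cases X-wf (IsOrd-transitive-subset oδ X⊆δ (X-transitive members-wf))
    where
    X⊆δ : X ⊆ δ
    X⊆δ x xX = proj₁ (proj₁ (hX x) xX)
    X-transitive : (∀ x → E x X → InWF E x) → IsTransitiveSet X
    X-transitive members-wf y z yX zy =
      let zδ = proj₁ oδ y z (X⊆δ y yX) zy
      in proj₂ (hX z) (zδ , P-wf z (IsOrd-∈ oδ zδ) (InWF-∈-closed zy (members-wf y yX)))
    cases : InWF E X → X ≡ δ ⊎ E X δ → ⊥
    cases X-wf (inj₁ refl) = ¬wf-δ X-wf
    cases X-wf (inj₂ Xδ) = ∈-refl⇒¬InWF {E = E} (proj₂ (hX X) (Xδ , P-wf X (IsOrd-∈ oδ Xδ) X-wf)) X-wf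

proposition2p6 : ExcludedMiddle 0ℓ →
    (M : Set) (E : M → M → Set) → ZF M E → NonStandard M E →
    (S : M → Set) → Separative M E S →
    (θ : Formula) (ρ : ℕ → M) →
    (∀ α → IsOrd E α → InWF E α → Sat E S (ρ [ 0 ↦ α ]) θ) →
    Σ M λ γ → IsOrd E γ × ¬ InWF E γ × Sat E S (ρ [ 0 ↦ γ ]) θ
proposition2p6 em M E zf ns S separative θ ρ θ-on-wf =
  let (δ , δ-ord , δ-nonstandard) = nonstandard-ordinal ns
      (X , hX) = separative θ ρ δ
      (γ , γX , γ-nonstandard) = overspill (λ α → Sat E S (ρ [ 0 ↦ α ]) θ) δ-ord δ-nonstandard hX θ-on-wf
      (γδ , θγ) = proj₁ (hX γ) γX
  in γ , IsOrd-∈ δ-ord γδ , γ-nonstandard , θγ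
  where
  open ZFBasics zf
  open NonstandardModel em zf
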